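{- Let $f:[\omega]^{\omega}\to[\omega]^{\omega}$ be a continuous map such that $f(X)\subseteq X$ for every $X\in[\omega]^{\omega}$, and let $R$ be a binary relation on a discrete space $A$. For every continuous $\varphi:[\omega]^{\omega}\to A$ there exists $Z\in[\omega]^{\omega}$ such that either $\varphi(Y)\,R\,\varphi(f(Y))$ for every $Y\in[Z]^{\omega}$, or $\neg\bigl(\varphi(Y)\,R\,\varphi(f(Y))\bigr)$ for every $Y\in[Z]^{\omega}$.
   Context: For $X\subseteq\omega$ infinite, $[X]^{\omega}$ denotes the set of infinite subsets of $X$, topologized as a subspace of the Cantor space $2^{\omega}$ (identifying sets with their characteristic functions). -}

module Defs where

open import Data.Nat using (ℕ; _≤_; _<_)
open import Data.Bool using (Bool; true)
open import Data.Product using (Σ; ∃; _×_; proj₁)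
open import Relation.Binary.PropositionalEquality using (_≡_)

Subset : Set
Subset = ℕ → Bool

_∈ₛ_ : ℕ → Subset → Set
n ∈ₛ X = X n ≡ true

Infinite : Subset → Set
Infinite X = ∀ n → ∃ λ m → n ≤ m × m ∈ₛ X

InfSet : Set
InfSet = Σ Subset Infinite

_⊆ₛ_ : Subset → Subset → Set
X ⊆ₛ Y = ∀ n → n ∈ₛ X → n ∈ₛ Y

AgreeBelow : ℕ → Subset → Subset → Set
AgreeBelow m X Y = ∀ i → i < m → X i ≡ Y i

-- continuity of f : [ω]^ω → [ω]^ω (subspace topology of the Cantor space)
ContinuousSelf : (InfSet → InfSet) → Set
ContinuousSelf f = ∀ (X : InfSet) (n : ℕ) → ∃ λ m → ∀ (Y : InfSet) →
  AgreeBelow m (proj₁ X) (proj₁ Y) →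
  AgreeBelow n (proj₁ (f X)) (proj₁ (f Y))

-- continuity of φ : [ω]^ω → A with A discrete (local constancy)
ContinuousDiscrete : {A : Set} → (InfSet → A) → Set
ContinuousDiscrete φ = ∀ (X : InfSet) → ∃ λ m → ∀ (Y : InfSet) →
  AgreeBelow m (proj₁ X) (proj₁ Y) → φ Y ≡ φ X

-- Galvin–Prikry for open sets, by combinatorial forcing. By continuity the set P of those Y with
-- φ Y R φ (f Y) is open. A finite stem s is accepted by B if s ∪ Y ∈ P for every infinite Y ⊆ B
-- above s, and rejected by B if no infinite subset of B accepts it. A first fusion yields Z₁ whose
-- tails decide every stem. If Z₁ accepts the empty stem, Z₁ is homogeneous for P. Otherwise a
-- rejected stem has only finitely many unrejected one-point extensions, so a second fusion yields
-- W ⊆ Z₁ all of whose stems, in particular all initial segments of each Y ⊆ W, are rejected; then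
-- no Y ⊆ W lies in P, since openness of P at Y would make an initial segment of Y accepted.
module Submission where

open import Defs
open import Level using (0ℓ)
open import Axiom.ExcludedMiddle using (ExcludedMiddle)
open import Axiom.DoubleNegationElimination using (em⇒dne)
open import Data.Bool using (Bool; true; false; if_then_else_)
open import Data.Bool.Properties using (¬-not)
open import Data.Empty using (⊥-elim)
open import Data.Nat using (ℕ; zero; suc; _≤_; _<_; z≤n; s≤s; _⊔_; _≟_; _<?_)
open import Data.Nat.Properties
open import Data.Product using (Σ; ∃; _×_; proj₁; proj₂; _,_)
open import Data.Sum using (_⊎_; inj₁; inj₂)
open import Function using (case_of_; _∘_)
open import Relation.Nullary using (¬_; yes; no; does)
open import Relation.Nullary.Decidable using (dec-true; dec-false)
open import Relation.Binary.PropositionalEquality using (_≡_; _≢_; refl; sym; trans; subst; subst₂)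

record _⊑_ (C B : InfSet) : Set where
  constructor ⊆⇒⊑
  field ⊑⇒⊆ : proj₁ C ⊆ₛ proj₁ B
open _⊑_

⊑-refl : ∀ {B} → B ⊑ B
⊑-refl = ⊆⇒⊑ λ _ n∈B → n∈B

⊑-trans : ∀ {A B C} → A ⊑ B → B ⊑ C → A ⊑ C
⊑-trans A⊑B B⊑C = ⊆⇒⊑ λ n n∈A → ⊑⇒⊆ B⊑C n (⊑⇒⊆ A⊑B n n∈A)

agree-sym : ∀ {a S S'} → AgreeBelow a S S' → AgreeBelow a S' S
agree-sym S≈S' i i<a = sym (S≈S' i i<a)

agree-≤ : ∀ {m n S S'} → m ≤ n → AgreeBelow n S S' → AgreeBelow m S S'
agree-≤ m≤n S≈S' i i<m = S≈S' i (<-≤-trans i<m m≤n)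

∅ : Subset
∅ _ = false

ω : InfSet
ω = (λ _ → true) , λ n → n , ≤-refl , refl

opaque
  singleton : ℕ → Subset
  singleton b n = does (n ≟ b)

  singleton-self : ∀ b → singleton b b ≡ true
  singleton-self b = dec-true (b ≟ b) refl

  singleton-≢ : ∀ {b n} → n ≢ b → singleton b n ≡ false
  singleton-≢ {b} {n} = dec-false (n ≟ b)

  splice : ℕ → Subset → Subset → Subset
  splice a S Y n = if does (n <? a) then S n else Y n

  splice-< : ∀ {a S Y n} → n < a → splice a S Y n ≡ S n
  splice-< {a} {n = n} n<a rewrite dec-true (n <? a) n<a = refl

  splice-≥ : ∀ {a S Y n} → a ≤ n → splice a S Y n ≡ Y n
  splice-≥ {a} {n = n} a≤n rewrite dec-false (n <? a) (≤⇒≯ a≤n) = refl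

splice-cong : ∀ {a S S'} → AgreeBelow a S S' → ∀ Y n → splice a S Y n ≡ splice a S' Y n
splice-cong {a} S≈S' Y n with n <? a
... | yes n<a = trans (splice-< n<a) (trans (S≈S' n n<a) (sym (splice-< n<a)))
... | no n≮a = trans (splice-≥ (≮⇒≥ n≮a)) (sym (splice-≥ (≮⇒≥ n≮a)))

splice-infinite : ∀ a S {Y} → Infinite Y → Infinite (splice a S Y)
splice-infinite a S Y-inf n with Y-inf (n ⊔ a)
... | m , n⊔a≤m , m∈Y =
  m , ≤-trans (m≤m⊔n n a) n⊔a≤m , trans (splice-≥ (≤-trans (m≤n⊔m n a) n⊔a≤m)) m∈Y

spliceInf : ℕ → Subset → InfSet → InfSet
spliceInf a S Y = splice a S (proj₁ Y) , splice-infinite a S (proj₂ Y)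

restrictFrom : ℕ → InfSet → InfSet
restrictFrom c = spliceInf c ∅

restrictFrom-≥ : ∀ {c X n} → n ∈ₛ proj₁ (restrictFrom c X) → c ≤ n
restrictFrom-≥ {c} {X} {n} n∈ with n <? c
... | yes n<c = case trans (sym (splice-< {S = ∅} {proj₁ X} n<c)) n∈ of λ ()
... | no n≮c = ≮⇒≥ n≮c

restrictFrom-⊑ : ∀ {c X} → restrictFrom c X ⊑ X
restrictFrom-⊑ {c} {X} = ⊆⇒⊑ λ n n∈ → trans (sym (splice-≥ (restrictFrom-≥ {c} {X} n∈))) n∈

-- Removing the least element b of Y and re-adding it to the stem leaves the splice unchanged.
splice-least : ∀ {a b S} (Y : Subset) → a ≤ b → b ∈ₛ Y → (∀ m → m < b → Y m ≡ false) →
               ∀ n → splice (suc b) (splice a S (singleton b)) (splice (suc b) ∅ Y) n ≡ splice a S Y n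
splice-least {a} {b} Y a≤b b∈Y b-least n with n <? a | n <? suc b
... | yes n<a | _ = trans (splice-< (<-≤-trans n<a (m≤n⇒m≤1+n a≤b)))
                      (trans (splice-< n<a) (sym (splice-< n<a)))
... | no n≮a | no n≮1+b = trans (splice-≥ (≮⇒≥ n≮1+b))
                            (trans (splice-≥ (≮⇒≥ n≮1+b)) (sym (splice-≥ (≮⇒≥ n≮a))))
... | no n≮a | yes n<1+b =
  trans (splice-< n<1+b) (trans (splice-≥ (≮⇒≥ n≮a))
    (trans (singleton≡Y (m≤n⇒m<n∨m≡n (m<1+n⇒m≤n n<1+b))) (sym (splice-≥ (≮⇒≥ n≮a)))))
  where
  singleton≡Y : n < b ⊎ n ≡ b → singleton b n ≡ Y n
  singleton≡Y (inj₁ n<b) = trans (singleton-≢ (<⇒≢ n<b)) (sym (b-least n n<b))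
  singleton≡Y (inj₂ refl) = trans (singleton-self n) (sym b∈Y)

least-element : (X : Subset) → ∀ {n} → n ∈ₛ X →
                ∃ λ b → b ∈ₛ X × (∀ m → m < b → X m ≡ false)
least-element X {n} n∈X = case search (suc n) of λ where
    (inj₁ none) → case trans (sym n∈X) (none n ≤-refl) of λ ()
    (inj₂ least) → least
  where
  search : ∀ k → (∀ m → m < k → X m ≡ false) ⊎
                  ∃ λ b → b ∈ₛ X × (∀ m → m < b → X m ≡ false)
  search zero = inj₁ λ _ ()
  search (suc k) with search k
  ... | inj₂ least = inj₂ least
  ... | inj₁ none-below-k with X k in X-k
  ...   | true = inj₂ (k , X-k , none-below-k)
  ...   | false = inj₁ λ m m<1+k → case m≤n⇒m<n∨m≡n (m<1+n⇒m≤n m<1+k) of λ where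
           (inj₁ m<k) → none-below-k m m<k
           (inj₂ refl) → X-k

IsOpen : (InfSet → Set) → Set
IsOpen P = ∀ Y → ∃ λ m → ∀ Y' → AgreeBelow m (proj₁ Y) (proj₁ Y') → P Y → P Y'

module Classical (lem : ExcludedMiddle 0ℓ) where

  dne : ∀ {A : Set} → ¬ ¬ A → A
  dne = em⇒dne lem

  opaque
    setOf : (ℕ → Set) → Subset
    setOf Q n = does (lem {Q n})

    ∈-setOf⁺ : ∀ {Q n} → Q n → n ∈ₛ setOf Q
    ∈-setOf⁺ {Q} {n} = dec-true (lem {Q n})

    ∈-setOf⁻ : ∀ {Q n} → n ∈ₛ setOf Q → Q n
    ∈-setOf⁻ {Q} {n} n∈ with lem {Q n}
    ... | yes q = q
    ... | no _ = case n∈ of λ ()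

  infSetOf : (Q : ℕ → Set) → (∀ n → ∃ λ m → n ≤ m × Q m) → InfSet
  infSetOf Q unbounded = setOf Q , λ n →
    let m , n≤m , q = unbounded n in m , n≤m , ∈-setOf⁺ q

  module Increasing (z : ℕ → ℕ) (z-< : ∀ k → z k < z (suc k)) where

    k≤z[k] : ∀ k → k ≤ z k
    k≤z[k] zero = z≤n
    k≤z[k] (suc k) = <-≤-trans (s≤s (k≤z[k] k)) (z-< k)

    z-mono-≤ : ∀ {i j} → i ≤ j → z i ≤ z j
    z-mono-≤ {j = zero} z≤n = ≤-refl
    z-mono-≤ {j = suc j} i≤1+j with m≤n⇒m<n∨m≡n i≤1+j
    ... | inj₁ i<1+j = ≤-trans (z-mono-≤ (m<1+n⇒m≤n i<1+j)) (<⇒≤ (z-< j))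
    ... | inj₂ refl = ≤-refl

    z-cancel-< : ∀ {i j} → z i < z j → i < j
    z-cancel-< {i} {j} zi<zj with i <? j
    ... | yes i<j = i<j
    ... | no i≮j = ⊥-elim (<⇒≱ zi<zj (z-mono-≤ (≮⇒≥ i≮j)))

    bound : ℕ → ℕ
    bound zero = 0
    bound (suc k) = suc (z k)

    bound≤z : ∀ k → bound k ≤ z k
    bound≤z zero = z≤n
    bound≤z (suc k) = z-< k

    k≤bound : ∀ k → k ≤ bound k
    k≤bound zero = z≤n
    k≤bound (suc k) = s≤s (k≤z[k] k)

    z<bound : ∀ {i k} → i < k → z i < bound k
    z<bound {k = suc k} i<1+k = s≤s (z-mono-≤ (m<1+n⇒m≤n i<1+k))

    Tail : ℕ → InfSet
    Tail k = infSetOf (λ n → ∃ λ i → k ≤ i × z i ≡ n)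
      λ n → z (n ⊔ k) , ≤-trans (m≤m⊔n n k) (k≤z[k] (n ⊔ k)) , n ⊔ k , m≤n⊔m n k , refl

    z∈Tail : ∀ {k i} → k ≤ i → z i ∈ₛ proj₁ (Tail k)
    z∈Tail {i = i} k≤i = ∈-setOf⁺ (i , k≤i , refl)

    ∈Tail⁻ : ∀ {k n} → n ∈ₛ proj₁ (Tail k) → ∃ λ i → k ≤ i × z i ≡ n
    ∈Tail⁻ = ∈-setOf⁻

    Tail-≥ : ∀ {k n} → n ∈ₛ proj₁ (Tail k) → z k ≤ n
    Tail-≥ n∈ with ∈Tail⁻ n∈
    ... | i , k≤i , refl = z-mono-≤ k≤i

    Tail-antitone : ∀ {k j} → k ≤ j → Tail j ⊑ Tail k
    Tail-antitone k≤j = ⊆⇒⊑ λ n n∈ → case ∈Tail⁻ n∈ of λ where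
      (i , j≤i , refl) → z∈Tail (≤-trans k≤j j≤i)

    Tail-suc : ∀ {j n} → n ∈ₛ proj₁ (Tail 0) → z j < n → n ∈ₛ proj₁ (Tail (suc j))
    Tail-suc n∈ zj<n with ∈Tail⁻ n∈
    ... | i , _ , refl = z∈Tail (z-cancel-< zj<n)

  -- Fusion: a property that is dense below B₀ is met, for all stems at once, by the tails of a
  -- single set (Q-Tail), choosing z k and then shrinking for the 2^(z k + 1) stems ending at z k.
  module Fusion (B₀ : InfSet) (Q : ℕ → Subset → InfSet → Set)
    (Q-⊑ : ∀ {a S B C} → C ⊑ B → Q a S B → Q a S C)
    (Q-stem : ∀ {a S S' B} → AgreeBelow a S S' → Q a S B → Q a S' B)
    (Q-dense : ∀ a S B → B ⊑ B₀ → Σ InfSet λ C → C ⊑ B × Q a S C) where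

    private
      overwrite : ℕ → Bool → Subset → Subset
      overwrite k b T n = if does (n ≟ k) then b else T n

      agree-overwrite : ∀ {k a T} (S : Subset) → (∀ i → suc k ≤ i → i < a → S i ≡ T i) →
                        ∀ i → k ≤ i → i < a → S i ≡ overwrite k (S k) T i
      agree-overwrite {k} S S≈T i k≤i i<a with i ≟ k
      ... | yes refl rewrite dec-true (k ≟ k) refl = refl
      ... | no i≢k rewrite dec-false (i ≟ k) i≢k = S≈T i (≤∧≢⇒< k≤i (i≢k ∘ sym)) i<a

    -- Induction on the number k of free coordinates; at k = a every stem is covered.
    dense-from : ∀ k a T B → B ⊑ B₀ → Σ InfSet λ C → C ⊑ B ×
                 (∀ S → (∀ i → k ≤ i → i < a → S i ≡ T i) → Q a S C)
    dense-from zero a T B B⊑B₀ with Q-dense a T B B⊑B₀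
    ... | C , C⊑B , q = C , C⊑B , λ S S≈T → Q-stem (λ i i<a → sym (S≈T i z≤n i<a)) q
    dense-from (suc k) a T B B⊑B₀ with dense-from k a (overwrite k false T) B B⊑B₀
    ... | C₁ , C₁⊑B , q₁ with dense-from k a (overwrite k true T) C₁ (⊑-trans C₁⊑B B⊑B₀)
    ... | C₂ , C₂⊑C₁ , q₂ = C₂ , ⊑-trans C₂⊑C₁ C₁⊑B , both
      where
      both : ∀ S → (∀ i → suc k ≤ i → i < a → S i ≡ T i) → Q a S C₂
      both S S≈T with S k | agree-overwrite S S≈T
      ... | false | S≈T' = Q-⊑ C₂⊑C₁ (q₁ S S≈T')
      ... | true | S≈T' = q₂ S S≈T'

    dense-all-stems : ∀ a B → B ⊑ B₀ → Σ InfSet λ C → C ⊑ B × (∀ S → Q a S C)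
    dense-all-stems a B B⊑B₀ with dense-from a a ∅ B B⊑B₀
    ... | C , C⊑B , q = C , C⊑B , λ S → q S λ i a≤i i<a → ⊥-elim (<⇒≱ i<a a≤i)

    record Stage : Set where
      field
        bound : ℕ
        set : InfSet
        set⊑B₀ : set ⊑ B₀
        decided : ∀ S → Q bound S set

      pivot : ℕ
      pivot = proj₁ (proj₂ set bound)

      bound≤pivot : bound ≤ pivot
      bound≤pivot = proj₁ (proj₂ (proj₂ set bound))

      pivot∈set : pivot ∈ₛ proj₁ set
      pivot∈set = proj₂ (proj₂ (proj₂ set bound))

    refine : (s : Stage) → Σ InfSet λ C → C ⊑ Stage.set s × (∀ S → Q (suc (Stage.pivot s)) S C)
    refine s = dense-all-stems (suc (Stage.pivot s)) (Stage.set s) (Stage.set⊑B₀ s)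

    next : Stage → Stage
    next s = record
      { bound = suc (Stage.pivot s)
      ; set = proj₁ (refine s)
      ; set⊑B₀ = ⊑-trans (proj₁ (proj₂ (refine s))) (Stage.set⊑B₀ s)
      ; decided = proj₂ (proj₂ (refine s))
      }

    next⊑ : ∀ s → Stage.set (next s) ⊑ Stage.set s
    next⊑ s = proj₁ (proj₂ (refine s))

    first : Stage
    first = record
      { bound = 0
      ; set = proj₁ (dense-all-stems 0 B₀ ⊑-refl)
      ; set⊑B₀ = proj₁ (proj₂ (dense-all-stems 0 B₀ ⊑-refl))
      ; decided = proj₂ (proj₂ (dense-all-stems 0 B₀ ⊑-refl))
      }

    opaque
      stage : ℕ → Stage
      stage zero = first
      stage (suc k) = next (stage k)

      z : ℕ → ℕ
      z k = Stage.pivot (stage k)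

      z-< : ∀ k → z k < z (suc k)
      z-< k = Stage.bound≤pivot (stage (suc k))

    open Increasing z z-< public

    opaque
      unfolding z

      stage-bound : ∀ k → Stage.bound (stage k) ≡ bound k
      stage-bound zero = refl
      stage-bound (suc k) = refl

      z∈stage : ∀ k → z k ∈ₛ proj₁ (Stage.set (stage k))
      z∈stage k = Stage.pivot∈set (stage k)

      stage-antitone : ∀ {k j} → k ≤ j → Stage.set (stage j) ⊑ Stage.set (stage k)
      stage-antitone {j = zero} z≤n = ⊑-refl
      stage-antitone {j = suc j} k≤1+j with m≤n⇒m<n∨m≡n k≤1+j
      ... | inj₁ k<1+j = ⊑-trans (next⊑ (stage j)) (stage-antitone (m<1+n⇒m≤n k<1+j))
      ... | inj₂ refl = ⊑-refl

    Tail⊑stage : ∀ k → Tail k ⊑ Stage.set (stage k)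
    Tail⊑stage k = ⊆⇒⊑ λ n n∈ → case ∈Tail⁻ n∈ of λ where
      (i , k≤i , refl) → ⊑⇒⊆ (stage-antitone k≤i) (z i) (z∈stage i)

    Q-Tail : ∀ k S → Q (bound k) S (Tail k)
    Q-Tail k S = subst (λ b → Q b S (Tail k)) (stage-bound k) (Q-⊑ (Tail⊑stage k) (Stage.decided (stage k) S))

    Tail⊑B₀ : Tail 0 ⊑ B₀
    Tail⊑B₀ = ⊑-trans (Tail⊑stage 0) (Stage.set⊑B₀ (stage 0))

  -- Combinatorial forcing: a pair (a, S) stands for the finite stem S ∩ [0,a).
  module GalvinPrikry (P : InfSet → Set) (P-open : IsOpen P) where

    P-≗ : ∀ {X Y} → (∀ n → proj₁ X n ≡ proj₁ Y n) → P X → P Y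
    P-≗ {X} {Y} X≗Y = proj₂ (P-open X) Y λ i _ → X≗Y i

    record Accepts (a : ℕ) (S : Subset) (B : InfSet) : Set where
      constructor accepts
      field accepted : ∀ Y → Y ⊑ B → P (spliceInf a S Y)
    open Accepts

    Rejects : ℕ → Subset → InfSet → Set
    Rejects a S B = ∀ C → C ⊑ B → ¬ Accepts a S C

    Accepts-transfer : ∀ {a a' S S' C} →
                       (∀ Y → Y ⊑ C → ∀ n → splice a S (proj₁ Y) n ≡ splice a' S' (proj₁ Y) n) →
                       Accepts a S C → Accepts a' S' C
    Accepts-transfer splices≗ acc = accepts λ Y Y⊑C → P-≗ (splices≗ Y Y⊑C) (accepted acc Y Y⊑C)

    Accepts-stem : ∀ {a S S' B} → AgreeBelow a S S' → Accepts a S B → Accepts a S' B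
    Accepts-stem S≈S' = Accepts-transfer λ Y _ → splice-cong S≈S' (proj₁ Y)

    Decides : ℕ → Subset → InfSet → Set
    Decides a S B = Accepts a S B ⊎ Rejects a S B

    Decides-⊑ : ∀ {a S B C} → C ⊑ B → Decides a S B → Decides a S C
    Decides-⊑ C⊑B (inj₁ acc) = inj₁ (accepts λ Y Y⊑C → accepted acc Y (⊑-trans Y⊑C C⊑B))
    Decides-⊑ C⊑B (inj₂ rej) = inj₂ λ D D⊑C → rej D (⊑-trans D⊑C C⊑B)

    Decides-stem : ∀ {a S S' B} → AgreeBelow a S S' → Decides a S B → Decides a S' B
    Decides-stem S≈S' (inj₁ acc) = inj₁ (Accepts-stem S≈S' acc)
    Decides-stem S≈S' (inj₂ rej) = inj₂ λ C C⊑B acc → rej C C⊑B (Accepts-stem (agree-sym S≈S') acc)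

    Decides-dense : ∀ a S B → B ⊑ ω → Σ InfSet λ C → C ⊑ B × Decides a S C
    Decides-dense a S B _ with lem {Σ InfSet λ C → C ⊑ B × Accepts a S C}
    ... | yes (C , C⊑B , acc) = C , C⊑B , inj₁ acc
    ... | no ¬acc = B , ⊑-refl , inj₂ λ C C⊑B acc → ¬acc (C , C⊑B , acc)

    module Decisive = Fusion ω Decides Decides-⊑ Decides-stem Decides-dense

    Z₁ : InfSet
    Z₁ = Decisive.Tail 0

    record RejectsAbove (a : ℕ) (S : Subset) : Set where
      constructor rejectsAbove
      field rejectedAbove : ∀ C → C ⊑ Z₁ → (∀ n → n ∈ₛ proj₁ C → a ≤ n) → ¬ Accepts a S C
    open RejectsAbove

    RejectsAbove-stem : ∀ {a S S'} → AgreeBelow a S S' → RejectsAbove a S → RejectsAbove a S'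
    RejectsAbove-stem S≈S' rej = rejectsAbove λ C C⊑Z₁ C≥a acc →
      rejectedAbove rej C C⊑Z₁ C≥a (Accepts-stem (agree-sym S≈S') acc)

    RejectsAbove-raise : ∀ {a a' S} → a ≤ a' → (∀ n → a ≤ n → n < a' → S n ≡ false) →
                         RejectsAbove a S → RejectsAbove a' S
    RejectsAbove-raise {a} {a'} {S} a≤a' S-empty rej = rejectsAbove λ C C⊑Z₁ C≥a' acc →
      rejectedAbove rej C C⊑Z₁ (λ n n∈C → ≤-trans a≤a' (C≥a' n n∈C))
        (Accepts-transfer (λ Y Y⊑C → splices≗ (proj₁ Y) λ n n∈Y → C≥a' n (⊑⇒⊆ Y⊑C n n∈Y)) acc)
      where
      splices≗ : ∀ Y → (∀ n → n ∈ₛ Y → a' ≤ n) →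
                 ∀ n → splice a' S Y n ≡ splice a S Y n
      splices≗ Y Y≥a' n with n <? a | n <? a'
      ... | yes n<a | _ = trans (splice-< (<-≤-trans n<a a≤a')) (sym (splice-< n<a))
      ... | no n≮a | no n≮a' = trans (splice-≥ (≮⇒≥ n≮a')) (sym (splice-≥ (≮⇒≥ n≮a)))
      ... | no n≮a | yes n<a' =
        trans (splice-< n<a') (trans (S-empty n (≮⇒≥ n≮a) n<a')
          (sym (trans (splice-≥ (≮⇒≥ n≮a)) (¬-not λ n∈Y → <⇒≱ n<a' (Y≥a' n n∈Y)))))

    unrejected⇒Tail-accepts : ∀ i T → ¬ RejectsAbove (suc (Decisive.z i)) T →
                              Accepts (suc (Decisive.z i)) T (Decisive.Tail (suc i))
    unrejected⇒Tail-accepts i T ¬rej with Decisive.Q-Tail (suc i) T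
    ... | inj₁ acc = acc
    ... | inj₂ rej = ⊥-elim (¬rej (rejectsAbove λ C C⊑Z₁ C>zi → rej C
          (⊆⇒⊑ λ n n∈C → Decisive.Tail-suc (⊑⇒⊆ C⊑Z₁ n n∈C) (C>zi n n∈C))))

    Propagates : ℕ → Subset → InfSet → Set
    Propagates a S B = RejectsAbove a S → ∀ b → b ∈ₛ proj₁ B → a ≤ b →
                       RejectsAbove (suc b) (splice a S (singleton b))

    Propagates-⊑ : ∀ {a S B C} → C ⊑ B → Propagates a S B → Propagates a S C
    Propagates-⊑ C⊑B prop rej b b∈C = prop rej b (⊑⇒⊆ C⊑B b b∈C)

    Propagates-stem : ∀ {a S S' B} → AgreeBelow a S S' → Propagates a S B → Propagates a S' B
    Propagates-stem S≈S' prop rej b b∈B a≤b =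
      RejectsAbove-stem (λ i _ → splice-cong S≈S' (singleton b) i)
        (prop (RejectsAbove-stem (agree-sym S≈S') rej) b b∈B a≤b)

    Unrejected : ℕ → Subset → InfSet → ℕ → Set
    Unrejected a S B m = m ∈ₛ proj₁ B × a ≤ m × ¬ RejectsAbove (suc m) (splice a S (singleton m))

    -- Otherwise the stem would be accepted by the set of its unrejected one-point extensions:
    -- a subset Y of that set is the extension by min Y, followed by the rest of Y.
    unrejected-bounded : ∀ {a S B} → RejectsAbove a S → B ⊑ Z₁ →
                         ¬ (∀ n → ∃ λ m → n ≤ m × Unrejected a S B m)
    unrejected-bounded {a} {S} {B} rej B⊑Z₁ unbounded =
      rejectedAbove rej E E⊑Z₁ (λ n n∈E → proj₁ (proj₂ (∈-setOf⁻ n∈E))) (accepts E-accepts)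
      where
      E : InfSet
      E = infSetOf (Unrejected a S B) unbounded

      E⊑B : E ⊑ B
      E⊑B = ⊆⇒⊑ λ n n∈E → proj₁ (∈-setOf⁻ n∈E)

      E⊑Z₁ : E ⊑ Z₁
      E⊑Z₁ = ⊑-trans E⊑B B⊑Z₁

      E-accepts : ∀ Y → Y ⊑ E → P (spliceInf a S Y)
      E-accepts Y Y⊑E with least-element (proj₁ Y) (proj₂ (proj₂ (proj₂ Y 0)))
      ... | b , b∈Y , b-least with ∈-setOf⁻ {Unrejected a S B} (⊑⇒⊆ Y⊑E b b∈Y)
      ... | _ , a≤b , ¬rej with Decisive.∈Tail⁻ (⊑⇒⊆ (⊑-trans Y⊑E E⊑Z₁) b b∈Y)
      ... | i , _ , refl =
        P-≗ (splice-least (proj₁ Y) a≤b b∈Y b-least)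
          (accepted (unrejected⇒Tail-accepts i _ ¬rej) (restrictFrom (suc b) Y) rest⊑Tail)
        where
        rest⊑Tail : restrictFrom (suc b) Y ⊑ Decisive.Tail (suc i)
        rest⊑Tail = ⊆⇒⊑ λ n n∈ → Decisive.Tail-suc
          (⊑⇒⊆ (⊑-trans restrictFrom-⊑ (⊑-trans Y⊑E E⊑Z₁)) n n∈) (restrictFrom-≥ {X = Y} n∈)

    Propagates-dense : ∀ a S B → B ⊑ Z₁ → Σ InfSet λ C → C ⊑ B × Propagates a S C
    Propagates-dense a S B B⊑Z₁ with lem {RejectsAbove a S}
    ... | no ¬rej = B , ⊑-refl , λ rej → ⊥-elim (¬rej rej)
    ... | yes rej = restrictFrom N B , restrictFrom-⊑ , propagates
      where
      bounded : ∃ λ N → ∀ m → N ≤ m → ¬ Unrejected a S B m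
      bounded = dne λ ¬bounded → unrejected-bounded rej B⊑Z₁ λ n →
        dne λ ¬above → ¬bounded (n , λ m n≤m unrej → ¬above (m , n≤m , unrej))

      N : ℕ
      N = proj₁ bounded

      propagates : Propagates a S (restrictFrom N B)
      propagates _ b b∈ a≤b = dne λ ¬rej →
        proj₂ bounded b (restrictFrom-≥ {X = B} b∈) (⊑⇒⊆ (restrictFrom-⊑ {N} {B}) b b∈ , a≤b , ¬rej)

    module Propagating = Fusion Z₁ Propagates Propagates-⊑ (λ {B = B} → Propagates-stem {B = B}) Propagates-dense
    open Propagating using (z; bound; bound≤z)

    W : InfSet
    W = Propagating.Tail 0

    module _ (Y : InfSet) (Y⊑W : Y ⊑ W) where

      empty-gap : ∀ k n → bound k ≤ n → n < z k → proj₁ Y n ≡ false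
      empty-gap k n bound≤n n<zk = ¬-not λ n∈Y →
        case Propagating.∈Tail⁻ (⊑⇒⊆ Y⊑W n n∈Y) of λ where
          (i , _ , refl) → <⇒≱ (Propagating.z<bound (Propagating.z-cancel-< n<zk)) bound≤n

      -- Inductively along the enumeration of W, using Propagates when z k ∈ Y and the gap otherwise.
      rejects-initial-segments : Rejects 0 ∅ Z₁ → ∀ k → RejectsAbove (bound k) (proj₁ Y)
      rejects-initial-segments rej₀ zero =
        RejectsAbove-stem (λ _ ()) (rejectsAbove λ C C⊑Z₁ _ → rej₀ C C⊑Z₁)
      rejects-initial-segments rej₀ (suc k) with proj₁ Y (z k) in zk∈?
      ... | true = RejectsAbove-stem Y≈
          (Propagating.Q-Tail k (proj₁ Y) (rejects-initial-segments rej₀ k) (z k)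
            (Propagating.z∈Tail ≤-refl) (bound≤z k))
        where
        Y≈ : AgreeBelow (suc (z k)) (splice (bound k) (proj₁ Y) (singleton (z k))) (proj₁ Y)
        Y≈ n n<1+zk with n <? bound k | m≤n⇒m<n∨m≡n (m<1+n⇒m≤n n<1+zk)
        ... | yes n<bound | _ = splice-< n<bound
        ... | no n≮bound | inj₁ n<zk = trans (splice-≥ (≮⇒≥ n≮bound))
          (trans (singleton-≢ (<⇒≢ n<zk)) (sym (empty-gap k n (≮⇒≥ n≮bound) n<zk)))
        ... | no n≮bound | inj₂ refl = trans (splice-≥ (≮⇒≥ n≮bound))
          (trans (singleton-self n) (sym zk∈?))
      ... | false = RejectsAbove-raise (≤-trans (bound≤z k) (n≤1+n _)) Y-empty (rejects-initial-segments rej₀ k)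
        where
        Y-empty : ∀ n → bound k ≤ n → n < suc (z k) → proj₁ Y n ≡ false
        Y-empty n bound≤n n<1+zk with m≤n⇒m<n∨m≡n (m<1+n⇒m≤n n<1+zk)
        ... | inj₁ n<zk = empty-gap k n bound≤n n<zk
        ... | inj₂ refl = zk∈?

    galvin-prikry : ∃ λ (Z : InfSet) →
      (∀ Y → proj₁ Y ⊆ₛ proj₁ Z → P Y) ⊎ (∀ Y → proj₁ Y ⊆ₛ proj₁ Z → ¬ P Y)
    galvin-prikry with Decisive.Q-Tail 0 ∅
    ... | inj₁ acc = Z₁ , inj₁ λ Y Y⊆Z₁ → P-≗ (λ n → splice-≥ z≤n) (accepted acc Y (⊆⇒⊑ Y⊆Z₁))
    ... | inj₂ rej₀ = W , inj₂ avoids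
      where
      -- Openness of P at Y makes the stem Y ∩ [0, bound m) accepted by a tail of W, yet it is rejected.
      avoids : ∀ Y → proj₁ Y ⊆ₛ proj₁ W → ¬ P Y
      avoids Y Y⊆W PY with P-open Y
      ... | m , P-near-Y = rejectedAbove (rejects-initial-segments Y (⊆⇒⊑ Y⊆W) rej₀ m) (Propagating.Tail m)
        (⊑-trans (Propagating.Tail-antitone z≤n) Propagating.Tail⊑B₀)
        (λ n n∈ → ≤-trans (bound≤z m) (Propagating.Tail-≥ n∈))
        (accepts λ Y' _ → P-near-Y (spliceInf (bound m) (proj₁ Y) Y')
          (λ i i<m → sym (splice-< (<-≤-trans i<m (Propagating.k≤bound m)))) PY)

continuous-relation-isOpen : (f : InfSet → InfSet) → ContinuousSelf f → {A : Set} (R : A → A → Set) →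
                             (φ : InfSet → A) → ContinuousDiscrete φ → IsOpen (λ Y → R (φ Y) (φ (f Y)))
continuous-relation-isOpen f f-cont R φ φ-cont Y with φ-cont Y | φ-cont (f Y)
... | m₁ , φ-const₁ | m₂ , φ-const₂ with f-cont Y m₂
... | m₃ , f-const₃ = m₁ ⊔ m₃ , λ Y' Y≈Y' →
  subst₂ R (sym (φ-const₁ Y' (agree-≤ (m≤m⊔n m₁ m₃) Y≈Y')))
           (sym (φ-const₂ (f Y') (f-const₃ Y' (agree-≤ (m≤n⊔m m₁ m₃) Y≈Y'))))

proposition4p1 : ExcludedMiddle 0ℓ →
    (f : InfSet → InfSet) → ContinuousSelf f →
    (∀ (X : InfSet) → proj₁ (f X) ⊆ₛ proj₁ X) →
    (A : Set) (R : A → A → Set) →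
    (φ : InfSet → A) → ContinuousDiscrete φ →
    ∃ λ (Z : InfSet) →
      (∀ (Y : InfSet) → proj₁ Y ⊆ₛ proj₁ Z → R (φ Y) (φ (f Y)))
      ⊎ (∀ (Y : InfSet) → proj₁ Y ⊆ₛ proj₁ Z → ¬ R (φ Y) (φ (f Y)))
proposition4p1 lem f f-cont _ A R φ φ-cont =
  Classical.GalvinPrikry.galvin-prikry lem _ (continuous-relation-isOpen f f-cont R φ φ-cont)
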